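{- Let $x$ be a universal variable and let $b$ be either a universal variable or an existential variable with dependency set $D_b$ (for universal $b$, $D_b=\{b\}$). Let $a$ and $a'$ be extension variables built, respectively, on extension variables $t_1,\dots,t_k$ and $t'_1,\dots,t'_k$ (introduced by IndExt in this order), where the defining IndExt line of each $t'_i$ (and of $a'$) differs from that of $t_i$ (resp. $a$) only by replacing inputs $t_j$ ($j<i$) by $t'_j$ and the input $x$ by $b$, wherever these inputs occur. Suppose that in every defining line $\alpha\to(v\leftrightarrow B)$ of $a$ and of the $t_i$, neither $x$ nor any variable of $D_b$ occurs in $\alpha$. Then there is a D-Frege+$\forall$red proof of $(x\leftrightarrow b)\to(a\leftrightarrow a')$ of size $O(w^2k)$, where $w$ is the maximum width of the clauses involved.
   Context: An S-form DQBF is $\forall U\exists E\,\phi$ with universal variables $U$, existential variables $E$ each with a dependency set $D_x\subseteq U$, and quantifier-free matrix $\phi$; $D_u=\{u\}$ for universal $u$. D-Frege+$\forall$red: derivations are sequences of propositional formulas, each obtained by one of: (Frege) an axiom or rule of a fixed Frege system applied to earlier lines; (Axiom) a conjunct of $\phi$; (IndExt) a line $\alpha\to(v\leftrightarrow\bigwedge_{y\in Y}y)$ or $\alpha\to(v\leftrightarrow\bigvee_{y\in Y}y)$ (the defining line of $v$), where $\alpha$ is a conjunction of universal literals, $Y$ a set of literals of existing variables (the inputs), and $v$ a fresh variable added as existential with $D_v=(\bigcup_{y\in Y}D_{\mathrm{var}(y)})\setminus\mathrm{var}(\alpha)$; ($\forall$-red) from $L(u)$ derive $L(0)$ or $L(1)$,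 where $u$ is universal and no existential variable $x$ occurring in $L$ has $u\in D_x$; (prefix weakening) the prefix may be extended by a new variable not occurring in the matrix. -}

module Defs where

open import Data.Nat using (ℕ; _≡ᵇ_; _+_; _⊔_)
open import Data.Bool using (Bool; true; false; if_then_else_; _∧_; not)
open import Data.Bool.ListAction using (any)
open import Data.Maybe using (Maybe; just; nothing)
open import Data.Product using (_×_; _,_; proj₁; proj₂)
open import Data.List using (List; []; _∷_; length)
open import Data.List.Membership.Propositional using (_∈_)
open import Data.List.Relation.Unary.All using (All)
open import Data.Empty using (⊥)
open import Data.Unit using (⊤)
open import Relation.Binary.PropositionalEquality using (_≡_; _≢_)
open import Relation.Nullary using (¬_)

infixr 6 _∧'_
infixr 5 _∨'_
infixr 4 _⇒_ _⇔_

data Fm : Set where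
  var       : ℕ → Fm
  ⊤' ⊥'     : Fm
  ¬'_       : Fm → Fm
  _∧'_ _∨'_ : Fm → Fm → Fm
  _⇒_ _⇔_   : Fm → Fm → Fm

size : Fm → ℕ
size (var _)  = 1
size ⊤'       = 1
size ⊥'       = 1
size (¬' A)   = 1 + size A
size (A ∧' B) = 1 + size A + size B
size (A ∨' B) = 1 + size A + size B
size (A ⇒ B)  = 1 + size A + size B
size (A ⇔ B)  = 1 + size A + size B

data _occursIn_ (z : ℕ) : Fm → Set where
  here  : z occursIn var z
  neg   : ∀ {A} → z occursIn A → z occursIn (¬' A)
  ∧l    : ∀ {A B} → z occursIn A → z occursIn (A ∧' B)
  ∧r    : ∀ {A B} → z occursIn B → z occursIn (A ∧' B)
  ∨l    : ∀ {A B} → z occursIn A → z occursIn (A ∨' B)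
  ∨r    : ∀ {A B} → z occursIn B → z occursIn (A ∨' B)
  ⇒l    : ∀ {A B} → z occursIn A → z occursIn (A ⇒ B)
  ⇒r    : ∀ {A B} → z occursIn B → z occursIn (A ⇒ B)
  ⇔l    : ∀ {A B} → z occursIn A → z occursIn (A ⇔ B)
  ⇔r    : ∀ {A B} → z occursIn B → z occursIn (A ⇔ B)

const : Bool → Fm
const true  = ⊤'
const false = ⊥'

_[_≔_] : Fm → ℕ → Bool → Fm
var z    [ u ≔ c ] = if z ≡ᵇ u then const c else var z
⊤'       [ u ≔ c ] = ⊤'
⊥'       [ u ≔ c ] = ⊥'
(¬' A)   [ u ≔ c ] = ¬' (A [ u ≔ c ])
(A ∧' B) [ u ≔ c ] = (A [ u ≔ c ]) ∧' (B [ u ≔ c ])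
(A ∨' B) [ u ≔ c ] = (A [ u ≔ c ]) ∨' (B [ u ≔ c ])
(A ⇒ B)  [ u ≔ c ] = (A [ u ≔ c ]) ⇒ (B [ u ≔ c ])
(A ⇔ B)  [ u ≔ c ] = (A [ u ≔ c ]) ⇔ (B [ u ≔ c ])

Lit : Set
Lit = ℕ × Bool

lvar : Lit → ℕ
lvar = proj₁

litFm : Lit → Fm
litFm (z , true)  = var z
litFm (z , false) = ¬' var z

⋀ : List Lit → Fm
⋀ []       = ⊤'
⋀ (l ∷ ls) = litFm l ∧' ⋀ ls

⋁ : List Lit → Fm
⋁ []       = ⊥'
⋁ (l ∷ ls) = litFm l ∨' ⋁ ls

Consistent : List Lit → Set
Consistent α = ∀ {u p} → (u , p) ∈ α → (u , not p) ∈ α → ⊥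

-- The fixed Frege system: axiom schemas (Kleene's system extended by
-- schemas for ⇔, ⊤, ⊥) together with modus ponens.

data Ax : Fm → Set where
  k-ax    : ∀ A B   → Ax (A ⇒ (B ⇒ A))
  s-ax    : ∀ A B C → Ax ((A ⇒ B) ⇒ ((A ⇒ (B ⇒ C)) ⇒ (A ⇒ C)))
  ∧i      : ∀ A B   → Ax (A ⇒ (B ⇒ (A ∧' B)))
  ∧e₁     : ∀ A B   → Ax ((A ∧' B) ⇒ A)
  ∧e₂     : ∀ A B   → Ax ((A ∧' B) ⇒ B)
  ∨i₁     : ∀ A B   → Ax (A ⇒ (A ∨' B))
  ∨i₂     : ∀ A B   → Ax (B ⇒ (A ∨' B))
  ∨e      : ∀ A B C → Ax ((A ⇒ C) ⇒ ((B ⇒ C) ⇒ ((A ∨' B) ⇒ C)))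
  ¬i      : ∀ A B   → Ax ((A ⇒ B) ⇒ ((A ⇒ ¬' B) ⇒ ¬' A))
  ¬¬e     : ∀ A     → Ax ((¬' ¬' A) ⇒ A)
  ⇔e₁     : ∀ A B   → Ax ((A ⇔ B) ⇒ (A ⇒ B))
  ⇔e₂     : ∀ A B   → Ax ((A ⇔ B) ⇒ (B ⇒ A))
  ⇔i      : ∀ A B   → Ax ((A ⇒ B) ⇒ ((B ⇒ A) ⇒ (A ⇔ B)))
  ⊤i      : Ax ⊤'
  ⊥e      : ∀ A     → Ax (⊥' ⇒ A)

-- Prefixes: each variable is undeclared, universal, or existential with
-- a dependency set (given as a characteristic function on ℕ).

data Kind : Set where
  univ  : Kind
  exist : (ℕ → Bool) → Kind

Prefix : Set
Prefix = ℕ → Maybe Kind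

extend : Prefix → ℕ → Kind → Prefix
extend P v k z = if z ≡ᵇ v then just k else P z

inDep : Prefix → ℕ → ℕ → Bool
inDep P z u with P z
... | just univ      = z ≡ᵇ u
... | just (exist D) = D u
... | nothing        = false

Declared : Prefix → ℕ → Set
Declared P z = P z ≢ nothing

DepsOK : Prefix → Kind → Set
DepsOK P univ      = ⊤
DepsOK P (exist D) = ∀ u → D u ≡ true → P u ≡ just univ

-- S-form DQBF: prefix and matrix (list of conjuncts)

record DQBF : Set where
  field
    prefix : Prefix
    matrix : List Fm
open DQBF public

record WellFormed (Φ : DQBF) : Set where
  field
    deps-univ     : ∀ z k → prefix Φ z ≡ just k → DepsOK (prefix Φ) k
    matrix-closed : ∀ A z → A ∈ matrix Φ → z occursIn A → Declared (prefix Φ) z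

data Conn : Set where
  AND OR : Conn

record Def : Set where
  constructor mkDef
  field
    conn  : Conn
    guard : List Lit
    ins   : List Lit
    new   : ℕ
open Def public

body : Conn → List Lit → Fm
body AND Y = ⋀ Y
body OR  Y = ⋁ Y

defLine : Def → Fm
defLine d = ⋀ (guard d) ⇒ (var (new d) ⇔ body (conn d) (ins d))

depsOf : Prefix → Def → ℕ → Bool
depsOf P d u =
  any (λ y → inDep P (lvar y) u) (ins d) ∧ not (any (λ l → lvar l ≡ᵇ u) (guard d))

width : Def → ℕ
width d = length (guard d) + length (ins d) + 1

maxWidth : List Def → ℕ
maxWidth []       = 0
maxWidth (d ∷ ds) = width d ⊔ maxWidth ds

-- D-Frege+∀red derivations.  Lines are stored newest first.

record IndExtOK (φ : List Fm) (P : Prefix) (Γ : List Fm) (d : Def) : Set where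
  field
    guard-univ : All (λ l → P (lvar l) ≡ just univ) (guard d)
    ins-exist  : All (λ y → Declared P (lvar y)) (ins d)
    fresh-pre  : P (new d) ≡ nothing
    fresh-mat  : ∀ A → A ∈ φ → ¬ (new d occursIn A)
    fresh-der  : ∀ A → A ∈ Γ → ¬ (new d occursIn A)

data Step (φ : List Fm) (P : Prefix) (Γ : List Fm) : Prefix → Fm → Set where
  frege-ax : ∀ {A} → Ax A → Step φ P Γ P A
  frege-mp : ∀ {A B} → A ∈ Γ → (A ⇒ B) ∈ Γ → Step φ P Γ P B
  axiom    : ∀ {A} → A ∈ φ → Step φ P Γ P A
  indext   : (d : Def) → IndExtOK φ P Γ d →
             Step φ P Γ (extend P (new d) (exist (depsOf P d))) (defLine d)
  ∀red     : ∀ {L} (u : ℕ) (c : Bool) → L ∈ Γ → P u ≡ just univ →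
             (∀ z D → z occursIn L → P z ≡ just (exist D) → D u ≡ false) →
             Step φ P Γ P (L [ u ≔ c ])

data Deriv (φ : List Fm) : Prefix → List Fm → Prefix → List Fm → Set where
  done   : ∀ {P Γ} → Deriv φ P Γ P Γ
  line   : ∀ {P Γ P' A Q Δ} → Step φ P Γ P' A → Deriv φ P' (A ∷ Γ) Q Δ →
           Deriv φ P Γ Q Δ
  weaken : ∀ {P Γ Q Δ} (v : ℕ) (k : Kind) → P v ≡ nothing →
           (∀ A → A ∈ φ → ¬ (v occursIn A)) → DepsOK P k →
           Deriv φ (extend P v k) Γ Q Δ → Deriv φ P Γ Q Δ

dsize : ∀ {φ P Γ Q Δ} → Deriv φ P Γ Q Δ → ℕ
dsize done                   = 0
dsize (line {A = A} s π)     = size A + dsize π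
dsize (weaken v k _ _ _ π)   = dsize π

data InOrder {φ} : ∀ {P Γ Q Δ} → Deriv φ P Γ Q Δ → List Def → Set where
  nil   : ∀ {P Γ Q Δ} {π : Deriv φ P Γ Q Δ} → InOrder π []
  skip  : ∀ {P Γ P' A Q Δ ds} {s : Step φ P Γ P' A} {π : Deriv φ P' (A ∷ Γ) Q Δ} →
          InOrder π ds → InOrder (line s π) ds
  skipw : ∀ {P Γ Q Δ ds v k e f g} {π : Deriv φ (extend P v k) Γ Q Δ} →
          InOrder π ds → InOrder (weaken {P = P} v k e f g π) ds
  hit   : ∀ {P Γ Q Δ ds} {d : Def} {ok : IndExtOK φ P Γ d}
          {π : Deriv φ (extend P (new d) (exist (depsOf P d))) (defLine d ∷ Γ) Q Δ} →
          InOrder π ds → InOrder (line (indext d ok) π) (d ∷ ds)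

lookupRen : List (ℕ × ℕ) → ℕ → ℕ
lookupRen []             z = z
lookupRen ((o , n) ∷ ps) z = if z ≡ᵇ o then n else lookupRen ps z

ren : ℕ → ℕ → List (ℕ × ℕ) → ℕ → ℕ
ren x b ps z = if z ≡ᵇ x then b else lookupRen ps z

renLit : (ℕ → ℕ) → Lit → Lit
renLit ρ (z , p) = (ρ z , p)

mapLits : (ℕ → ℕ) → List Lit → List Lit
mapLits ρ []       = []
mapLits ρ (l ∷ ls) = renLit ρ l ∷ mapLits ρ ls

PrimedDef : (ℕ → ℕ) → Def → Def → Set
PrimedDef ρ d d' = (conn d' ≡ conn d) × (guard d' ≡ guard d) × (ins d' ≡ mapLits ρ (ins d))

-- chain of definitions (t_1,…,t_k,a) and their copies (t'_1,…,t'_k,a');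
-- ps records the already-treated pairs (t_j , t'_j)
PrimedChain : ℕ → ℕ → List (ℕ × ℕ) → List Def → List Def → Set
PrimedChain x b ps []       []         = ⊤
PrimedChain x b ps (d ∷ ds) (d' ∷ ds') =
  PrimedDef (ren x b ps) d d' × PrimedChain x b ((new d , new d') ∷ ps) ds ds'
PrimedChain x b ps []       (_ ∷ _)    = ⊥
PrimedChain x b ps (_ ∷ _)  []         = ⊥

GoodGuard : Prefix → ℕ → ℕ → Def → Set
GoodGuard P x b d =
  All (λ l → (lvar l ≢ x) × (inDep P b (lvar l) ≡ false)) (guard d) × Consistent (guard d)

-- Write H for x ⇔ b. Going along the chain we derive H ⇒ (tᵢ ⇔ t'ᵢ), keeping all earlier such
-- lines. For one pair with defining lines α ⇒ (v ⇔ B) and α ⇒ (v' ⇔ B'), each input of B' is the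
-- corresponding input of B or its renaming (x to b, tⱼ to t'ⱼ), which is H-equivalent to it by an
-- earlier line; congruence gives H ⇒ (B ⇔ B') literal by literal, and with the two defining lines
-- α ⇒ (H ⇒ (v ⇔ v')). The guard α is then removed by ∀-reduction: its variables are universal,
-- differ from x and b, and none of x, b, v, v' depends on them (for v and v' because IndExt removes
-- var(α) from their dependency sets), so each may be set to the value satisfying its literal; the
-- reduced guard is variable-free and true, and modus ponens discharges it. Every step instantiates
-- one of finitely many fixed schematic Frege proofs with formulas of size O(w), so a pair costs
-- O(w) lines of size O(w), and the chain O(w² k).

module Submission where

open import Defs
open import Data.Nat using (ℕ; zero; suc; _+_; _*_; _≤_; _≤?_; _≡ᵇ_; z≤n; s≤s)
open import Data.Nat.Properties
open import Data.Nat.Tactic.RingSolver using (solve-∀)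
open import Data.Bool using (Bool; true; false; T)
open import Data.Bool.Properties using (∧-zeroʳ; T-≡; ¬-not; not-involutive)
open import Data.Product using (Σ; _×_; _,_; proj₁; proj₂)
open import Data.Sum using (_⊎_; inj₁; inj₂)
open import Data.List using (List; []; _∷_; _∷ʳ_; length)
open import Data.List.Membership.Propositional using (_∈_)
open import Data.List.Relation.Binary.Subset.Propositional using (_⊆_)
open import Data.List.Relation.Unary.Any as Any using (here; there)
open import Data.List.Relation.Unary.Any.Properties using (any⁺)
open import Data.List.Relation.Unary.All as All using (All; []; _∷_)
open import Data.List.Relation.Unary.All.Properties using (∷ʳ⁺)
open import Data.Maybe using (just; nothing)
open import Data.Empty using (⊥-elim)
open import Function using (_∘_; Equivalence)
open import Relation.Nullary using (¬_)
open import Relation.Nullary.Decidable using (True; toWitness)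
open import Relation.Binary.PropositionalEquality

-- Formulas

≡ᵇ-refl : ∀ n → (n ≡ᵇ n) ≡ true
≡ᵇ-refl zero    = refl
≡ᵇ-refl (suc n) = ≡ᵇ-refl n

≡ᵇ-sound : ∀ {m n} → (m ≡ᵇ n) ≡ true → m ≡ n
≡ᵇ-sound {m} {n} eq = ≡ᵇ⇒≡ m n (subst T (sym eq) _)

occursIn-var⁻ : ∀ {z y} → z occursIn var y → z ≡ y
occursIn-var⁻ here = refl

size-const : ∀ c → size (const c) ≡ 1
size-const true  = refl
size-const false = refl

size-[≔] : ∀ F u c → size (F [ u ≔ c ]) ≡ size F
size-[≔] (var z) u c with z ≡ᵇ u
... | true  = size-const c
... | false = refl
size-[≔] ⊤'       u c = refl
size-[≔] ⊥'       u c = refl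
size-[≔] (¬' F)   u c = cong suc (size-[≔] F u c)
size-[≔] (F ∧' G) u c = cong suc (cong₂ _+_ (size-[≔] F u c) (size-[≔] G u c))
size-[≔] (F ∨' G) u c = cong suc (cong₂ _+_ (size-[≔] F u c) (size-[≔] G u c))
size-[≔] (F ⇒ G)  u c = cong suc (cong₂ _+_ (size-[≔] F u c) (size-[≔] G u c))
size-[≔] (F ⇔ G)  u c = cong suc (cong₂ _+_ (size-[≔] F u c) (size-[≔] G u c))

occursIn-[≔] : ∀ {z} F u c → z occursIn (F [ u ≔ c ]) → z occursIn F
occursIn-[≔] (var y) u c o with y ≡ᵇ u
occursIn-[≔] (var y) u true  () | true
occursIn-[≔] (var y) u false () | true
... | false = o
occursIn-[≔] (¬' F)   u c (neg o) = neg (occursIn-[≔] F u c o)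
occursIn-[≔] (F ∧' G) u c (∧l o)  = ∧l (occursIn-[≔] F u c o)
occursIn-[≔] (F ∧' G) u c (∧r o)  = ∧r (occursIn-[≔] G u c o)
occursIn-[≔] (F ∨' G) u c (∨l o)  = ∨l (occursIn-[≔] F u c o)
occursIn-[≔] (F ∨' G) u c (∨r o)  = ∨r (occursIn-[≔] G u c o)
occursIn-[≔] (F ⇒ G)  u c (⇒l o)  = ⇒l (occursIn-[≔] F u c o)
occursIn-[≔] (F ⇒ G)  u c (⇒r o)  = ⇒r (occursIn-[≔] G u c o)
occursIn-[≔] (F ⇔ G)  u c (⇔l o)  = ⇔l (occursIn-[≔] F u c o)
occursIn-[≔] (F ⇔ G)  u c (⇔r o)  = ⇔r (occursIn-[≔] G u c o)

[≔]-fresh : ∀ {u} F c → ¬ u occursIn F → F [ u ≔ c ] ≡ F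
[≔]-fresh {u} (var z) c u∉ with z ≡ᵇ u in eq
... | true  = ⊥-elim (u∉ (subst (_occursIn var z) (≡ᵇ-sound eq) here))
... | false = refl
[≔]-fresh ⊤'       c u∉ = refl
[≔]-fresh ⊥'       c u∉ = refl
[≔]-fresh (¬' F)   c u∉ = cong ¬'_ ([≔]-fresh F c (u∉ ∘ neg))
[≔]-fresh (F ∧' G) c u∉ = cong₂ _∧'_ ([≔]-fresh F c (u∉ ∘ ∧l)) ([≔]-fresh G c (u∉ ∘ ∧r))
[≔]-fresh (F ∨' G) c u∉ = cong₂ _∨'_ ([≔]-fresh F c (u∉ ∘ ∨l)) ([≔]-fresh G c (u∉ ∘ ∨r))
[≔]-fresh (F ⇒ G)  c u∉ = cong₂ _⇒_  ([≔]-fresh F c (u∉ ∘ ⇒l)) ([≔]-fresh G c (u∉ ∘ ⇒r))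
[≔]-fresh (F ⇔ G)  c u∉ = cong₂ _⇔_  ([≔]-fresh F c (u∉ ∘ ⇔l)) ([≔]-fresh G c (u∉ ∘ ⇔r))

-- ∀-reduction of a guard literal (u , c) sets u to c, the value satisfying the literal.
assign : List Lit → Fm → Fm
assign []            F = F
assign ((u , c) ∷ σ) F = assign σ (F [ u ≔ c ])

size-assign : ∀ σ F → size (assign σ F) ≡ size F
size-assign []            F = refl
size-assign ((u , c) ∷ σ) F = trans (size-assign σ (F [ u ≔ c ])) (size-[≔] F u c)

assign-const : ∀ σ c → assign σ (const c) ≡ const c
assign-const []      c     = refl
assign-const (_ ∷ σ) true  = assign-const σ true
assign-const (_ ∷ σ) false = assign-const σ false

assign-¬ : ∀ σ A → assign σ (¬' A) ≡ ¬' assign σ A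
assign-¬ []            A = refl
assign-¬ ((u , c) ∷ σ) A = assign-¬ σ (A [ u ≔ c ])

assign-∧ : ∀ σ A B → assign σ (A ∧' B) ≡ assign σ A ∧' assign σ B
assign-∧ []            A B = refl
assign-∧ ((u , c) ∷ σ) A B = assign-∧ σ (A [ u ≔ c ]) (B [ u ≔ c ])

-- Consistency makes the first binding of z the one with the polarity of any (z , p) ∈ σ.
assign-var : ∀ {σ z p} → Consistent σ → (z , p) ∈ σ → assign σ (var z) ≡ const p
assign-var {(u , c) ∷ σ} {z} {p} cons z∈ with z ≡ᵇ u in eq
... | true = trans (assign-const σ c) (cong const c≡p)
  where
  c≡p : c ≡ p
  c≡p = trans (¬-not λ c≡¬p → cons z∈ (here (cong₂ _,_ (≡ᵇ-sound eq) (sym c≡¬p))))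
              (not-involutive p)
... | false with z∈
...   | here refl with () ← trans (sym eq) (≡ᵇ-refl u)
...   | there z∈σ = assign-var (λ m m' → cons (there m) (there m')) z∈σ

⋀-occurs : ∀ {Q : ℕ → Set} {z} α → All (Q ∘ lvar) α → z occursIn ⋀ α → Q z
⋀-occurs ((_ , true)  ∷ _) (q ∷ _)  (∧l here)       = q
⋀-occurs ((_ , false) ∷ _) (q ∷ _)  (∧l (neg here)) = q
⋀-occurs (_ ∷ α)           (_ ∷ qs) (∧r o)          = ⋀-occurs α qs o

trueLit : Bool → Fm
trueLit true  = ⊤'
trueLit false = ¬' ⊥'

assign-lit : ∀ {σ z p} → Consistent σ → (z , p) ∈ σ → assign σ (litFm (z , p)) ≡ trueLit p
assign-lit {p = true}  cons z∈ = assign-var cons z∈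
assign-lit {σ} {z} {false} cons z∈ = trans (assign-¬ σ (var z)) (cong ¬'_ (assign-var cons z∈))

connective : Conn → Fm → Fm → Fm
connective AND = _∧'_
connective OR  = _∨'_

body-∷ : ∀ c l Y → body c (l ∷ Y) ≡ connective c (litFm l) (body c Y)
body-∷ AND l Y = refl
body-∷ OR  l Y = refl

size-litFm : ∀ l → size (litFm l) ≤ 2
size-litFm (z , true)  = s≤s z≤n
size-litFm (z , false) = ≤-refl

size-body : ∀ c Y → size (body c Y) ≤ 3 * length Y + 1
size-body AND []      = ≤-refl
size-body OR  []      = ≤-refl
size-body c   (l ∷ Y) rewrite body-∷ c l Y = ≤-trans
  (size-connective c (+-mono-≤ (size-litFm l) (size-body c Y)))
  (≤-reflexive (count (length Y)))
  where
  count : ∀ n → suc (2 + (3 * n + 1)) ≡ 3 * suc n + 1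
  count = solve-∀
  size-connective : ∀ c {A B n} → size A + size B ≤ n → size (connective c A B) ≤ suc n
  size-connective AND = s≤s
  size-connective OR  = s≤s

length-mapLits : ∀ ρ Z → length (mapLits ρ Z) ≡ length Z
length-mapLits ρ []      = refl
length-mapLits ρ (_ ∷ Z) = cong suc (length-mapLits ρ Z)

3n+1≤3[1+m] : ∀ {n m} → n ≤ m → 3 * n + 1 ≤ 3 * suc m
3n+1≤3[1+m] {n} {m} n≤m = begin
  3 * n + 1  ≡⟨ +-comm (3 * n) 1 ⟩
  1 + 3 * n  ≤⟨ +-monoˡ-≤ (3 * n) (s≤s (z≤n {2})) ⟩
  3 + 3 * n  ≡⟨ *-suc 3 n ⟨
  3 * suc n  ≤⟨ *-monoʳ-≤ 3 (s≤s n≤m) ⟩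
  3 * suc m  ∎
  where open ≤-Reasoning

-- Derivations and prefixes

module _ {φ : List Fm} where

  _++ᴰ_ : ∀ {P Γ Q Δ R Θ} → Deriv φ P Γ Q Δ → Deriv φ Q Δ R Θ → Deriv φ P Γ R Θ
  done                 ++ᴰ ρ = ρ
  line s π             ++ᴰ ρ = line s (π ++ᴰ ρ)
  weaken v k e f g π   ++ᴰ ρ = weaken v k e f g (π ++ᴰ ρ)

  dsize-++ᴰ : ∀ {P Γ Q Δ R Θ} (π : Deriv φ P Γ Q Δ) (ρ : Deriv φ Q Δ R Θ) →
              dsize (π ++ᴰ ρ) ≡ dsize π + dsize ρ
  dsize-++ᴰ done                 ρ = refl
  dsize-++ᴰ (line {A = A} s π)   ρ = trans (cong (size A +_) (dsize-++ᴰ π ρ)) (sym (+-assoc (size A) _ _))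
  dsize-++ᴰ (weaken _ _ _ _ _ π) ρ = dsize-++ᴰ π ρ

  lines-⊆ : ∀ {P Γ Q Δ} → Deriv φ P Γ Q Δ → Γ ⊆ Δ
  lines-⊆ done                 = λ m → m
  lines-⊆ (line s π)           = lines-⊆ π ∘ there
  lines-⊆ (weaken _ _ _ _ _ π) = lines-⊆ π

_⊑_ : Prefix → Prefix → Set
P ⊑ Q = ∀ {z k} → P z ≡ just k → Q z ≡ just k

extend-⊑ : ∀ P v k → P v ≡ nothing → P ⊑ extend P v k
extend-⊑ P v k Pv≡nothing {z} Pz≡k with z ≡ᵇ v in eq
... | true  with () ← trans (sym Pz≡k) (subst (λ w → P w ≡ nothing) (sym (≡ᵇ-sound eq)) Pv≡nothing)
... | false = Pz≡k

extend-new : ∀ P v k → extend P v k v ≡ just k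
extend-new P v k rewrite ≡ᵇ-refl v = refl

step-⊑ : ∀ {φ P Γ P' A} → Step φ P Γ P' A → P ⊑ P'
step-⊑ (frege-ax _)            = λ e → e
step-⊑ (frege-mp _ _)          = λ e → e
step-⊑ (axiom _)               = λ e → e
step-⊑ {P = P} (indext d ok)   = extend-⊑ P (new d) _ (IndExtOK.fresh-pre ok)
step-⊑ (∀red _ _ _ _ _)        = λ e → e

deriv-⊑ : ∀ {φ P Γ Q Δ} → Deriv φ P Γ Q Δ → P ⊑ Q
deriv-⊑ done                             = λ e → e
deriv-⊑ (line s π)                       = deriv-⊑ π ∘ step-⊑ s
deriv-⊑ {P = P} (weaken v k fresh _ _ π) = deriv-⊑ π ∘ extend-⊑ P v k fresh

univ≢exist : ∀ {D} → just univ ≢ just (exist D)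
univ≢exist ()

exist-injective : ∀ {D D'} → just (exist D) ≡ just (exist D') → D ≡ D'
exist-injective refl = refl

inDep-univ : ∀ {P z} u → P z ≡ just univ → inDep P z u ≡ (z ≡ᵇ u)
inDep-univ {P} {z} u e rewrite e = refl

inDep-exist : ∀ {P z D} u → P z ≡ just (exist D) → inDep P z u ≡ D u
inDep-exist {P} {z} u e rewrite e = refl

depsOf-guard : ∀ P d {l} → l ∈ guard d → depsOf P d (lvar l) ≡ false
depsOf-guard P d {l} l∈
  rewrite Equivalence.to T-≡ (any⁺ (λ l' → lvar l' ≡ᵇ lvar l)
                                   (Any.map (λ { refl → ≡⇒≡ᵇ (lvar l) (lvar l) refl }) l∈))
  = ∧-zeroʳ _

record Introduced (P : Prefix) (Γ : List Fm) (d : Def) : Set where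
  field
    defLine∈   : defLine d ∈ Γ
    deps       : ℕ → Bool
    new-exist  : P (new d) ≡ just (exist deps)
    guard∉deps : ∀ {l} → l ∈ guard d → deps (lvar l) ≡ false
    guard-univ : All (λ l → P (lvar l) ≡ just univ) (guard d)
open Introduced

guard-independent : ∀ {P Γ d l D} → Introduced P Γ d → l ∈ guard d → P (new d) ≡ just (exist D) →
                    D (lvar l) ≡ false
guard-independent I l∈ new-exist' =
  subst (λ D → D _ ≡ false) (exist-injective (trans (sym (new-exist I)) new-exist')) (guard∉deps I l∈)

Introduced-mono : ∀ {P Q Γ Δ d} → P ⊑ Q → Γ ⊆ Δ → Introduced P Γ d → Introduced Q Δ d
Introduced-mono P⊑Q Γ⊆Δ I = record
  { defLine∈   = Γ⊆Δ (defLine∈ I)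
  ; deps       = deps I
  ; new-exist  = P⊑Q (new-exist I)
  ; guard∉deps = guard∉deps I
  ; guard-univ = All.map P⊑Q (guard-univ I)
  }

inOrder⇒introduced : ∀ {φ P Γ Q Δ ds} {π : Deriv φ P Γ Q Δ} → InOrder π ds → All (Introduced Q Δ) ds
inOrder⇒introduced nil        = []
inOrder⇒introduced (skip io)  = inOrder⇒introduced io
inOrder⇒introduced (skipw io) = inOrder⇒introduced io
inOrder⇒introduced {P = P} (hit {d = d} {ok = ok} {π = π} io) =
  Introduced-mono (deriv-⊑ π) (lines-⊆ π) atDefinition ∷ inOrder⇒introduced io
  where
  atDefinition : Introduced (extend P (new d) (exist (depsOf P d))) (defLine d ∷ _) d
  atDefinition = record
    { defLine∈   = here refl
    ; deps       = depsOf P d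
    ; new-exist  = extend-new P (new d) _
    ; guard∉deps = depsOf-guard P d
    ; guard-univ = All.map (extend-⊑ P (new d) _ (IndExtOK.fresh-pre ok)) (IndExtOK.guard-univ ok)
    }

Last : Fm → List Fm → Set
Last A Δ = Σ (List Fm) λ Δ' → Δ ≡ A ∷ Δ'

module Fragments (φ : List Fm) (P : Prefix) (U : ℕ) where

  record Frag (Γ : List Fm) (Goal : List Fm → Set) (n : ℕ) : Set where
    constructor frag
    field
      {Δ}   : List Fm
      deriv : Deriv φ P Γ P Δ
      goal  : Goal Δ
      cost  : dsize deriv ≤ n * U

  Proves : List Fm → Fm → ℕ → Set
  Proves Γ A = Frag Γ (A ∈_)

  Ends : List Fm → Fm → ℕ → Set
  Ends Γ A = Frag Γ (Last A)

  pure : ∀ {Γ A} → A ∈ Γ → Proves Γ A 0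
  pure A∈Γ = frag done A∈Γ z≤n

  _>>=_ : ∀ {Γ A G n m} → Proves Γ A n → (∀ {Δ} → Γ ⊆ Δ × A ∈ Δ → Frag Δ G m) → Frag Γ G (n + m)
  _>>=_ {n = n} {m} (frag π A∈ c) k with k (lines-⊆ π , A∈)
  ... | frag ρ g c' = frag (π ++ᴰ ρ) g (begin
    dsize (π ++ᴰ ρ)    ≡⟨ dsize-++ᴰ π ρ ⟩
    dsize π + dsize ρ  ≤⟨ +-mono-≤ c c' ⟩
    n * U + m * U      ≡⟨ *-distribʳ-+ U n m ⟨
    (n + m) * U        ∎)
    where open ≤-Reasoning

  relax : ∀ {Γ G n m} → n ≤ m → Frag Γ G n → Frag Γ G m
  relax n≤m (frag π g c) = frag π g (≤-trans c (*-monoˡ-≤ U n≤m))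

  emit : ∀ {Γ A n} → Step φ P Γ P A → size A ≤ n * U → Ends Γ A n
  emit {A = A} s A≤ = frag (line s done) (_ , refl) (≤-trans (≤-reflexive (+-identityʳ (size A))) A≤)

  ends⇒proves : ∀ {Γ A n} → Ends Γ A n → Proves Γ A n
  ends⇒proves (frag π (_ , refl) c) = frag π (here refl) c

  cast : ∀ {Γ A B n} → A ≡ B → Proves Γ A n → Proves Γ B n
  cast refl p = p

rescale : ∀ {φ P U U' Γ G n m} → n * U ≤ m * U' →
          Fragments.Frag φ P U Γ G n → Fragments.Frag φ P U' Γ G m
rescale le (Fragments.frag π g c) = Fragments.frag π g (≤-trans c le)

-- Schematic proofs

data Schematic (hyps : List Fm) : Fm → Set where
  ax  : ∀ {A}   → Ax A → Schematic hyps A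
  hyp : ∀ {A}   → A ∈ hyps → Schematic hyps A
  mp  : ∀ {A B} → Schematic hyps A → Schematic hyps (A ⇒ B) → Schematic hyps B

weight : ∀ {hyps A} → Schematic hyps A → ℕ
weight (ax {A} _)       = size A
weight (hyp _)          = 0
weight (mp {B = B} s t) = weight s + weight t + size B

infixl 25 _⟪_⟫
_⟪_⟫ : Fm → (ℕ → Fm) → Fm
var i    ⟪ σ ⟫ = σ i
⊤'       ⟪ σ ⟫ = ⊤'
⊥'       ⟪ σ ⟫ = ⊥'
(¬' A)   ⟪ σ ⟫ = ¬' A ⟪ σ ⟫
(A ∧' B) ⟪ σ ⟫ = A ⟪ σ ⟫ ∧' B ⟪ σ ⟫
(A ∨' B) ⟪ σ ⟫ = A ⟪ σ ⟫ ∨' B ⟪ σ ⟫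
(A ⇒ B)  ⟪ σ ⟫ = A ⟪ σ ⟫ ⇒ B ⟪ σ ⟫
(A ⇔ B)  ⟪ σ ⟫ = A ⟪ σ ⟫ ⇔ B ⟪ σ ⟫

Ax-⟪⟫ : ∀ σ {A} → Ax A → Ax (A ⟪ σ ⟫)
Ax-⟪⟫ σ (k-ax A B)   = k-ax _ _
Ax-⟪⟫ σ (s-ax A B C) = s-ax _ _ _
Ax-⟪⟫ σ (∧i A B)     = ∧i _ _
Ax-⟪⟫ σ (∧e₁ A B)    = ∧e₁ _ _
Ax-⟪⟫ σ (∧e₂ A B)    = ∧e₂ _ _
Ax-⟪⟫ σ (∨i₁ A B)    = ∨i₁ _ _
Ax-⟪⟫ σ (∨i₂ A B)    = ∨i₂ _ _
Ax-⟪⟫ σ (∨e A B C)   = ∨e _ _ _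
Ax-⟪⟫ σ (¬i A B)     = ¬i _ _
Ax-⟪⟫ σ (¬¬e A)      = ¬¬e _
Ax-⟪⟫ σ (⇔e₁ A B)    = ⇔e₁ _ _
Ax-⟪⟫ σ (⇔e₂ A B)    = ⇔e₂ _ _
Ax-⟪⟫ σ (⇔i A B)     = ⇔i _ _
Ax-⟪⟫ σ ⊤i           = ⊤i
Ax-⟪⟫ σ (⊥e A)       = ⊥e _

at : List Fm → ℕ → Fm
at []       i       = ⊤'
at (A ∷ As) zero    = A
at (A ∷ As) (suc i) = at As i

at-≤ : ∀ {M} → 1 ≤ M → ∀ {Fs} → All (λ F → size F ≤ M) Fs → ∀ i → size (at Fs i) ≤ M
at-≤ 1≤M []             i       = 1≤M
at-≤ 1≤M (F≤M ∷ _)      zero    = F≤M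
at-≤ 1≤M (_   ∷ Fs≤M)   (suc i) = at-≤ 1≤M Fs≤M i

module _ {M : ℕ} {σ : ℕ → Fm} (1≤M : 1 ≤ M) (σ≤M : ∀ i → size (σ i) ≤ M) where

  private
    size-binary : ∀ {a b sa sb} → a ≤ sa * M → b ≤ sb * M → suc (a + b) ≤ suc (sa + sb) * M
    size-binary {sa = sa} {sb} a≤ b≤ =
      ≤-trans (+-mono-≤ 1≤M (+-mono-≤ a≤ b≤)) (≤-reflexive (cong (M +_) (sym (*-distribʳ-+ M sa sb))))

  size-⟪⟫ : ∀ A → size (A ⟪ σ ⟫) ≤ size A * M
  size-⟪⟫ (var i)  = ≤-trans (σ≤M i) (≤-reflexive (sym (+-identityʳ M)))
  size-⟪⟫ ⊤'       = ≤-trans 1≤M (≤-reflexive (sym (+-identityʳ M)))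
  size-⟪⟫ ⊥'       = ≤-trans 1≤M (≤-reflexive (sym (+-identityʳ M)))
  size-⟪⟫ (¬' A)   = +-mono-≤ 1≤M (size-⟪⟫ A)
  size-⟪⟫ (A ∧' B) = size-binary {sa = size A} (size-⟪⟫ A) (size-⟪⟫ B)
  size-⟪⟫ (A ∨' B) = size-binary {sa = size A} (size-⟪⟫ A) (size-⟪⟫ B)
  size-⟪⟫ (A ⇒ B)  = size-binary {sa = size A} (size-⟪⟫ A) (size-⟪⟫ B)
  size-⟪⟫ (A ⇔ B)  = size-binary {sa = size A} (size-⟪⟫ A) (size-⟪⟫ B)

  module _ {φ : List Fm} {P : Prefix} where
    open Fragments φ P M

    realise : ∀ {Γ hyps A} (t : Schematic hyps A) → All (λ h → h ⟪ σ ⟫ ∈ Γ) hyps →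
              Proves Γ (A ⟪ σ ⟫) (weight t)
    realise (ax {A} a) hs = ends⇒proves (emit (frege-ax (Ax-⟪⟫ σ a)) (size-⟪⟫ A))
    realise (hyp h)    hs = pure (All.lookup hs h)
    realise (mp {B = B} s t) hs =
      relax (≤-reflexive (sym (+-assoc (weight s) (weight t) (size B)))) do
        (Γ⊆Δ , A∈) ← realise s hs
        (Δ⊆Θ , A⇒B∈) ← realise t (All.map Γ⊆Δ hs)
        ends⇒proves (emit (frege-mp (Δ⊆Θ A∈) A⇒B∈) (size-⟪⟫ B))

module _ {hyps : List Fm} where

  ⇒-refl : ∀ A → Schematic hyps (A ⇒ A)
  ⇒-refl A = mp (ax (k-ax A (A ⇒ A))) (mp (ax (k-ax A A)) (ax (s-ax A (A ⇒ A) A)))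

  ⇔-refl : ∀ A → Schematic hyps (A ⇔ A)
  ⇔-refl A = mp (⇒-refl A) (mp (⇒-refl A) (ax (⇔i A A)))

  lift : ∀ C {A} → Schematic hyps A → Schematic hyps (C ⇒ A)
  lift C {A} t = mp t (ax (k-ax A C))

  module _ {C : Fm} where

    mp-under : ∀ {A B} → Schematic hyps (C ⇒ A) → Schematic hyps (C ⇒ (A ⇒ B)) → Schematic hyps (C ⇒ B)
    mp-under {A} {B} t u = mp u (mp t (ax (s-ax C A B)))

    ax-under : ∀ {A} → Ax A → Schematic hyps (C ⇒ A)
    ax-under a = lift C (ax a)

    const-under : ∀ X {A} → Schematic hyps (C ⇒ A) → Schematic hyps (C ⇒ (X ⇒ A))
    const-under X {A} t = mp-under t (ax-under (k-ax A X))

    mp-under₂ : ∀ {X A B} → Schematic hyps (C ⇒ (X ⇒ A)) → Schematic hyps (C ⇒ (X ⇒ (A ⇒ B))) →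
                Schematic hyps (C ⇒ (X ⇒ B))
    mp-under₂ {X} {A} {B} t u = mp-under u (mp-under t (ax-under (s-ax X A B)))

    ⇒-trans-under : ∀ {A B D} → Schematic hyps (C ⇒ (A ⇒ B)) → Schematic hyps (C ⇒ (B ⇒ D)) →
                    Schematic hyps (C ⇒ (A ⇒ D))
    ⇒-trans-under {A} t u = mp-under₂ t (const-under A u)

    contrapose-under : ∀ {A B} → Schematic hyps (C ⇒ (A ⇒ B)) → Schematic hyps (C ⇒ (¬' B ⇒ ¬' A))
    contrapose-under {A} {B} t = ⇒-trans-under (ax-under (k-ax (¬' B) A)) (mp-under t (ax-under (¬i A B)))

    ∧-mono-under : ∀ {A A' B B'} → Schematic hyps (C ⇒ (A ⇒ A')) → Schematic hyps (C ⇒ (B ⇒ B')) →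
                   Schematic hyps (C ⇒ ((A ∧' B) ⇒ (A' ∧' B')))
    ∧-mono-under {A} {A'} {B} {B'} t u =
      mp-under₂ (⇒-trans-under (ax-under (∧e₂ A B)) u)
        (mp-under₂ (⇒-trans-under (ax-under (∧e₁ A B)) t) (const-under (A ∧' B) (ax-under (∧i A' B'))))

    ∨-mono-under : ∀ {A A' B B'} → Schematic hyps (C ⇒ (A ⇒ A')) → Schematic hyps (C ⇒ (B ⇒ B')) →
                   Schematic hyps (C ⇒ ((A ∨' B) ⇒ (A' ∨' B')))
    ∨-mono-under {A} {A'} {B} {B'} t u =
      mp-under (⇒-trans-under u (ax-under (∨i₂ A' B')))
        (mp-under (⇒-trans-under t (ax-under (∨i₁ A' B'))) (ax-under (∨e A B (A' ∨' B'))))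

    ⇔-⇒ : ∀ {A B} → Schematic hyps (C ⇒ (A ⇔ B)) → Schematic hyps (C ⇒ (A ⇒ B))
    ⇔-⇒ {A} {B} t = mp-under t (ax-under (⇔e₁ A B))

    ⇔-⇐ : ∀ {A B} → Schematic hyps (C ⇒ (A ⇔ B)) → Schematic hyps (C ⇒ (B ⇒ A))
    ⇔-⇐ {A} {B} t = mp-under t (ax-under (⇔e₂ A B))

    ⇔-intro : ∀ {A B} → Schematic hyps (C ⇒ (A ⇒ B)) → Schematic hyps (C ⇒ (B ⇒ A)) →
              Schematic hyps (C ⇒ (A ⇔ B))
    ⇔-intro {A} {B} t u = mp-under u (mp-under t (ax-under (⇔i A B)))

    ⇔-sym-under : ∀ {A B} → Schematic hyps (C ⇒ (A ⇔ B)) → Schematic hyps (C ⇒ (B ⇔ A))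
    ⇔-sym-under t = ⇔-intro (⇔-⇐ t) (⇔-⇒ t)

    ⇔-trans-under : ∀ {A B D} → Schematic hyps (C ⇒ (A ⇔ B)) → Schematic hyps (C ⇒ (B ⇔ D)) →
                    Schematic hyps (C ⇒ (A ⇔ D))
    ⇔-trans-under t u = ⇔-intro (⇒-trans-under (⇔-⇒ t) (⇔-⇒ u)) (⇒-trans-under (⇔-⇐ u) (⇔-⇐ t))

    ¬-cong-under : ∀ {A B} → Schematic hyps (C ⇒ (A ⇔ B)) → Schematic hyps (C ⇒ (¬' A ⇔ ¬' B))
    ¬-cong-under t = ⇔-intro (contrapose-under (⇔-⇐ t)) (contrapose-under (⇔-⇒ t))

    ∧-cong-under : ∀ {A A' B B'} → Schematic hyps (C ⇒ (A ⇔ A')) → Schematic hyps (C ⇒ (B ⇔ B')) →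
                   Schematic hyps (C ⇒ ((A ∧' B) ⇔ (A' ∧' B')))
    ∧-cong-under t u = ⇔-intro (∧-mono-under (⇔-⇒ t) (⇔-⇒ u)) (∧-mono-under (⇔-⇐ t) (⇔-⇐ u))

    ∨-cong-under : ∀ {A A' B B'} → Schematic hyps (C ⇒ (A ⇔ A')) → Schematic hyps (C ⇒ (B ⇔ B')) →
                   Schematic hyps (C ⇒ ((A ∨' B) ⇔ (A' ∨' B')))
    ∨-cong-under t u = ⇔-intro (∨-mono-under (⇔-⇒ t) (⇔-⇒ u)) (∨-mono-under (⇔-⇐ t) (⇔-⇐ u))

  ⇒-trans : ∀ {A B D} → Schematic hyps (A ⇒ B) → Schematic hyps (B ⇒ D) → Schematic hyps (A ⇒ D)
  ⇒-trans {A} t u = mp-under t (lift A u)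

  curry : ∀ {A B D} → Schematic hyps ((A ∧' B) ⇒ D) → Schematic hyps (A ⇒ (B ⇒ D))
  curry {A} {B} t = mp-under₂ (ax (∧i A B)) (const-under B (lift A t))

#0 #1 #2 #3 #4 #5 : Fm
#0 = var 0
#1 = var 1
#2 = var 2
#3 = var 3
#4 = var 4
#5 = var 5

⇒-reflˢ : Schematic [] (#0 ⇒ #0)
⇒-reflˢ = ⇒-refl #0

⇔-refl-underˢ : Schematic [] (#0 ⇒ (#1 ⇔ #1))
⇔-refl-underˢ = lift #0 (⇔-refl #1)

¬-congˢ : Schematic ((#0 ⇒ (#1 ⇔ #2)) ∷ []) (#0 ⇒ (¬' #1 ⇔ ¬' #2))
¬-congˢ = ¬-cong-under (hyp (here refl))

∧-congˢ : Schematic ((#0 ⇒ (#1 ⇔ #2)) ∷ (#0 ⇒ (#3 ⇔ #4)) ∷ []) (#0 ⇒ ((#1 ∧' #3) ⇔ (#2 ∧' #4)))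
∧-congˢ = ∧-cong-under (hyp (here refl)) (hyp (there (here refl)))

∨-congˢ : Schematic ((#0 ⇒ (#1 ⇔ #2)) ∷ (#0 ⇒ (#3 ⇔ #4)) ∷ []) (#0 ⇒ ((#1 ∨' #3) ⇔ (#2 ∨' #4)))
∨-congˢ = ∨-cong-under (hyp (here refl)) (hyp (there (here refl)))

⊤-∧ˢ : Schematic (#0 ∷ []) (⊤' ∧' #0)
⊤-∧ˢ = mp (hyp (here refl)) (mp (ax ⊤i) (ax (∧i ⊤' #0)))

¬⊥-∧ˢ : Schematic (#0 ∷ []) (¬' ⊥' ∧' #0)
¬⊥-∧ˢ = mp (hyp (here refl)) (mp ¬⊥ (ax (∧i (¬' ⊥') #0)))
  where
  ¬⊥ : Schematic (#0 ∷ []) (¬' ⊥')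
  ¬⊥ = mp (ax (⊥e (¬' ⊥'))) (mp (ax (⊥e ⊥')) (ax (¬i ⊥' ⊥')))

-- In the use below #0 is a guard α, #1 is H, #2 and #3 are v and v', #4 and #5 their defining bodies.
equivDefinedˢ : Schematic ((#0 ⇒ (#2 ⇔ #4)) ∷ (#0 ⇒ (#3 ⇔ #5)) ∷ (#1 ⇒ (#4 ⇔ #5)) ∷ [])
                          (#0 ⇒ (#1 ⇒ (#2 ⇔ #3)))
equivDefinedˢ = curry (⇔-trans-under v⇔B (⇔-trans-under B⇔B' (⇔-sym-under v'⇔B')))
  where
  v⇔B    = ⇒-trans (ax (∧e₁ #0 #1)) (hyp (here refl))
  v'⇔B'  = ⇒-trans (ax (∧e₁ #0 #1)) (hyp (there (here refl)))
  B⇔B'   = ⇒-trans (ax (∧e₂ #0 #1)) (hyp (there (there (here refl))))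

-- At least the weight of each schema above; `schema` below checks this by evaluation.
maxWeight : ℕ
maxWeight = 6500

-- The primed chain

PrimedChain-[]ˡ : ∀ {x b ps} ds {d} → ¬ PrimedChain x b ps [] (ds ∷ʳ d)
PrimedChain-[]ˡ []      ()
PrimedChain-[]ˡ (_ ∷ _) ()

PrimedChain-[]ʳ : ∀ {x b ps} ds {d} → ¬ PrimedChain x b ps (ds ∷ʳ d) []
PrimedChain-[]ʳ []      ()
PrimedChain-[]ʳ (_ ∷ _) ()

defLine-primed : ∀ {ρ d d'} → PrimedDef ρ d d' →
                 defLine d' ≡ (⋀ (guard d) ⇒ (var (new d') ⇔ body (conn d) (mapLits ρ (ins d))))
defLine-primed (conn≡ , guard≡ , ins≡) rewrite conn≡ | guard≡ | ins≡ = refl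

-- For definitions of width at most W, every formula plugged into a schema has size at most M.
module Primed (φ : List Fm) (P : Prefix) (x b W : ℕ) (x-univ : P x ≡ just univ) where

  M : ℕ
  M = 3 * suc W

  -- Opaque, since Agda would otherwise unfold maxWeight * M into thousands of additions.
  opaque
    U : ℕ
    U = maxWeight * M

  opaque
    unfolding U
    U-def : U ≡ maxWeight * M
    U-def = refl

  open Fragments φ P U

  H : Fm
  H = var x ⇔ var b

  H≤M : size H ≤ M
  H≤M = m≤m*n 3 (suc W)

  1≤M : 1 ≤ M
  1≤M = ≤-trans (s≤s z≤n) H≤M

  lit≤M : ∀ l → size (litFm l) ≤ M
  lit≤M l = ≤-trans (size-litFm l) (≤-trans (s≤s (s≤s z≤n)) H≤M)

  body≤M : ∀ c Y → length Y ≤ W → size (body c Y) ≤ M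
  body≤M c Y Y≤W = ≤-trans (size-body c Y) (3n+1≤3[1+m] Y≤W)

  ≤-unit : ∀ {n} → n ≤ U → n ≤ 1 * U
  ≤-unit n≤U = ≤-trans n≤U (≤-reflexive (sym (+-identityʳ U)))

  schema : ∀ {Γ hyps A} (t : Schematic hyps A) {_ : True (weight t ≤? maxWeight)} (Fs : List Fm) →
           All (λ F → size F ≤ M) Fs → All (λ h → h ⟪ at Fs ⟫ ∈ Γ) hyps → Proves Γ (A ⟪ at Fs ⟫) 1
  schema t {light} Fs Fs≤M hs = rescale
    (≤-unit (≤-trans (*-monoˡ-≤ M (toWitness light)) (≤-reflexive (sym U-def))))
    (realise 1≤M (at-≤ 1≤M Fs≤M) t hs)

  Equated : List Fm → List (ℕ × ℕ) → Set
  Equated Γ = All (λ (t , t') → (H ⇒ (var t ⇔ var t')) ∈ Γ)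

  lookupRen-equiv : ∀ ps {Γ} → Equated Γ ps → ∀ z →
                    ((H ⇒ (var z ⇔ var (lookupRen ps z))) ∈ Γ) ⊎ (lookupRen ps z ≡ z)
  lookupRen-equiv []              equated          z = inj₂ refl
  lookupRen-equiv ((t , t') ∷ ps) (t⇔t' ∷ equated) z with z ≡ᵇ t in eq
  ... | true  = inj₁ (subst (λ w → (H ⇒ (var w ⇔ var t')) ∈ _) (sym (≡ᵇ-sound eq)) t⇔t')
  ... | false = lookupRen-equiv ps equated z

  ren-equiv : ∀ ps {Γ} → Equated Γ ps → ∀ z → Proves Γ (H ⇒ (var z ⇔ var (ren x b ps z))) 1
  ren-equiv ps equated z with z ≡ᵇ x in eq
  ... | true with refl ← ≡ᵇ-sound {z} {x} eq = schema ⇒-reflˢ (H ∷ []) (H≤M ∷ []) []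
  ... | false with lookupRen-equiv ps equated z
  ...   | inj₁ z⇔ρz = relax z≤n (pure z⇔ρz)
  ...   | inj₂ ρz≡z rewrite ρz≡z = schema ⇔-refl-underˢ (H ∷ var z ∷ []) (H≤M ∷ 1≤M ∷ []) []

  lit-equiv : ∀ ps {Γ} → Equated Γ ps → ∀ l → Proves Γ (H ⇒ (litFm l ⇔ litFm (renLit (ren x b ps) l))) 2
  lit-equiv ps equated (z , true)  = relax (n≤1+n 1) (ren-equiv ps equated z)
  lit-equiv ps equated (z , false) = do
    (_ , z⇔ρz) ← ren-equiv ps equated z
    schema ¬-congˢ (H ∷ var z ∷ var (ren x b ps z) ∷ []) (H≤M ∷ 1≤M ∷ 1≤M ∷ []) (z⇔ρz ∷ [])

  connective-cong : ∀ c {Γ A A' B B'} → size A ≤ M → size A' ≤ M → size B ≤ M → size B' ≤ M →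
                    (H ⇒ (A ⇔ A')) ∈ Γ → (H ⇒ (B ⇔ B')) ∈ Γ →
                    Proves Γ (H ⇒ (connective c A B ⇔ connective c A' B')) 1
  connective-cong AND A≤ A'≤ B≤ B'≤ A⇔A' B⇔B' =
    schema ∧-congˢ (H ∷ _ ∷ _ ∷ _ ∷ _ ∷ []) (H≤M ∷ A≤ ∷ A'≤ ∷ B≤ ∷ B'≤ ∷ []) (A⇔A' ∷ B⇔B' ∷ [])
  connective-cong OR  A≤ A'≤ B≤ B'≤ A⇔A' B⇔B' =
    schema ∨-congˢ (H ∷ _ ∷ _ ∷ _ ∷ _ ∷ []) (H≤M ∷ A≤ ∷ A'≤ ∷ B≤ ∷ B'≤ ∷ []) (A⇔A' ∷ B⇔B' ∷ [])

  body-equiv : ∀ ps c Y {Γ} → Equated Γ ps → length Y ≤ W →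
               Proves Γ (H ⇒ (body c Y ⇔ body c (mapLits (ren x b ps) Y))) (3 * length Y + 1)
  body-equiv ps c []      equated _   =
    schema ⇔-refl-underˢ (H ∷ body c [] ∷ []) (H≤M ∷ body≤M c [] z≤n ∷ []) []
  body-equiv ps c (l ∷ Y) equated Y≤W = relax (≤-reflexive (count (length Y))) (cast (sym body-∷²) do
    (Γ⊆Δ , l⇔l') ← lit-equiv ps equated l
    (Δ⊆Θ , Y⇔Y') ← body-equiv ps c Y (All.map Γ⊆Δ equated) Y<W
    connective-cong c (lit≤M l) (lit≤M l') (body≤M c Y Y<W) (body≤M c Y' Y'<W) (Δ⊆Θ l⇔l') Y⇔Y')
    where
    ρ  = ren x b ps
    l' = renLit ρ l
    Y' = mapLits ρ Y
    Y<W : length Y ≤ W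
    Y<W = ≤-trans (n≤1+n _) Y≤W
    Y'<W : length Y' ≤ W
    Y'<W = subst (_≤ W) (sym (length-mapLits ρ Y)) Y<W
    body-∷² : (H ⇒ (body c (l ∷ Y) ⇔ body c (l' ∷ Y'))) ≡
              (H ⇒ (connective c (litFm l) (body c Y) ⇔ connective c (litFm l') (body c Y')))
    body-∷² = cong₂ (λ B B' → H ⇒ (B ⇔ B')) (body-∷ c l Y) (body-∷ c l' Y')
    count : ∀ n → 2 + ((3 * n + 1) + 1) ≡ 3 * suc n + 1
    count = solve-∀

  record Reducible (R : Fm) (u : ℕ) : Set where
    field
      universal   : P u ≡ just univ
      fresh       : ¬ u occursIn R
      independent : ∀ {z D} → z occursIn R → P z ≡ just (exist D) → D u ≡ false
  open Reducible

  reduce-all : ∀ R σ G {Γ} → All (Reducible R ∘ lvar) σ → (∀ {z} → z occursIn G → P z ≡ just univ) →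
               size (G ⇒ R) ≤ U → (G ⇒ R) ∈ Γ → Proves Γ (assign σ G ⇒ R) (length σ)
  reduce-all R []            G _        _      _      G⇒R = pure G⇒R
  reduce-all R ((u , c) ∷ σ) G (r ∷ rs) G-univ G⇒R≤U G⇒R = do
    (_ , reduced) ← ends⇒proves (emit (∀red u c G⇒R (universal r) independent-of-u) (≤-unit size≤U))
    reduce-all R σ (G [ u ≔ c ]) rs (G-univ ∘ occursIn-[≔] G u c)
      (≤-trans (≤-reflexive (cong (λ n → suc (n + size R)) (size-[≔] G u c))) G⇒R≤U)
      (subst (λ F → (G [ u ≔ c ] ⇒ F) ∈ _) ([≔]-fresh R c (fresh r)) reduced)
    where
    size≤U : size ((G ⇒ R) [ u ≔ c ]) ≤ U
    size≤U = ≤-trans (≤-reflexive (size-[≔] (G ⇒ R) u c)) G⇒R≤U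
    independent-of-u : ∀ z D → z occursIn (G ⇒ R) → P z ≡ just (exist D) → D u ≡ false
    independent-of-u z D (⇒l o) z-exist = ⊥-elim (univ≢exist (trans (sym (G-univ o)) z-exist))
    independent-of-u z D (⇒r o) z-exist = independent r o z-exist

  trueLit-∧ : ∀ p {Γ G} → size G ≤ M → G ∈ Γ → Proves Γ (trueLit p ∧' G) 1
  trueLit-∧ true  G≤M G = schema ⊤-∧ˢ  (_ ∷ []) (G≤M ∷ []) (G ∷ [])
  trueLit-∧ false G≤M G = schema ¬⊥-∧ˢ (_ ∷ []) (G≤M ∷ []) (G ∷ [])

  assigned-guard : ∀ σ β {Γ} → Consistent σ → All (_∈ σ) β → length β ≤ W →
                   Proves Γ (assign σ (⋀ β)) (length β + 1)
  assigned-guard σ [] _ _ _ =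
    cast (sym (assign-const σ true)) (ends⇒proves (emit (frege-ax ⊤i) (≤-unit 1≤U)))
    where
    1≤U : 1 ≤ U
    1≤U = ≤-trans 1≤M (≤-trans (m≤n*m M maxWeight) (≤-reflexive (sym U-def)))
  assigned-guard σ ((z , p) ∷ β) cons (z∈σ ∷ β⊆σ) β≤W =
    relax (≤-reflexive (+-comm (length β + 1) 1))
      (cast (sym (trans (assign-∧ σ _ _) (cong (_∧' _) (assign-lit cons z∈σ)))) do
        (_ , β-true) ← assigned-guard σ β cons β⊆σ β<W
        trueLit-∧ p (≤-trans (≤-reflexive (size-assign σ (⋀ β))) (body≤M AND β β<W)) β-true)
    where
    β<W : length β ≤ W
    β<W = ≤-trans (n≤1+n _) β≤W

  guard-reducible : ∀ {Γ d d' u p} → Introduced P Γ d → Introduced P Γ d' → guard d' ≡ guard d →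
                    All (λ l → (lvar l ≢ x) × (inDep P b (lvar l) ≡ false)) (guard d) → (u , p) ∈ guard d →
                    Reducible (H ⇒ (var (new d) ⇔ var (new d'))) u
  guard-reducible {d = d} {d'} {u} I I' guard≡ good u∈ = record
    { universal = u-univ ; fresh = u-fresh ; independent = u-independent }
    where
    u-univ : P u ≡ just univ
    u-univ = All.lookup (guard-univ I) u∈
    b-indep : inDep P b u ≡ false
    b-indep = proj₂ (All.lookup good u∈)
    u≢b : u ≢ b
    u≢b refl with () ← trans (sym b-indep) (trans (inDep-univ {P} u u-univ) (≡ᵇ-refl u))
    u≢exist : ∀ {z D} → P z ≡ just (exist D) → u ≢ z
    u≢exist z-exist refl = univ≢exist (trans (sym u-univ) z-exist)
    u-fresh : ¬ u occursIn (H ⇒ (var (new d) ⇔ var (new d')))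
    u-fresh (⇒l (⇔l o)) = proj₁ (All.lookup good u∈) (occursIn-var⁻ o)
    u-fresh (⇒l (⇔r o)) = u≢b (occursIn-var⁻ o)
    u-fresh (⇒r (⇔l o)) = u≢exist (new-exist I) (occursIn-var⁻ o)
    u-fresh (⇒r (⇔r o)) = u≢exist (new-exist I') (occursIn-var⁻ o)
    u-independent : ∀ {z D} → z occursIn (H ⇒ (var (new d) ⇔ var (new d'))) → P z ≡ just (exist D) →
                    D u ≡ false
    u-independent (⇒l (⇔l o)) z-exist with refl ← occursIn-var⁻ o =
      ⊥-elim (univ≢exist (trans (sym x-univ) z-exist))
    u-independent (⇒l (⇔r o)) z-exist with refl ← occursIn-var⁻ o =
      trans (sym (inDep-exist {P} u z-exist)) b-indep
    u-independent (⇒r (⇔l o)) z-exist with refl ← occursIn-var⁻ o = guard-independent I u∈ z-exist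
    u-independent (⇒r (⇔r o)) z-exist with refl ← occursIn-var⁻ o =
      guard-independent I' (subst (_ ∈_) (sym guard≡) u∈) z-exist

  equiv-primed : ∀ ps {Γ} d d' → Equated Γ ps → PrimedDef (ren x b ps) d d' →
                 Introduced P Γ d → Introduced P Γ d' → GoodGuard P x b d → width d ≤ W →
                 Ends Γ (H ⇒ (var (new d) ⇔ var (new d'))) (4 * W)
  equiv-primed ps {Γ} d d' equated primed I I' (good , cons) d≤W =
    relax (≤-trans count≤ (*-monoʳ-≤ 4 d≤W)) do
    (Γ⊆Δ , B⇔B') ← body-equiv ps c Y equated Y≤W
    (_ , guarded) ← schema equivDefinedˢ (⋀ α ∷ H ∷ var v ∷ var v' ∷ body c Y ∷ body c Y' ∷ [])
                      (body≤M AND α α≤W ∷ H≤M ∷ 1≤M ∷ 1≤M ∷ body≤M c Y Y≤W ∷ body≤M c Y' Y'≤W ∷ [])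
                      (Γ⊆Δ (defLine∈ I) ∷ Γ⊆Δ defLine'∈ ∷ B⇔B' ∷ [])
    (_ , reduced) ← reduce-all R α (⋀ α) reducible (⋀-occurs α (guard-univ I)) line≤U guarded
    (Θ⊆Ξ , guard-true) ← assigned-guard α α cons (All.tabulate (λ l∈ → l∈)) α≤W
    emit (frege-mp guard-true (Θ⊆Ξ reduced)) (≤-unit (≤-trans (m≤n+m 7 (suc (size (⋀ α)))) line≤U))
    where
    α  = guard d
    Y  = ins d
    c  = conn d
    v  = new d
    v' = new d'
    Y' = mapLits (ren x b ps) Y
    R  = H ⇒ (var v ⇔ var v')
    defLine'∈ : (⋀ α ⇒ (var v' ⇔ body c Y')) ∈ Γ
    defLine'∈ = subst (_∈ Γ) (defLine-primed {ren x b ps} {d} {d'} primed) (defLine∈ I')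
    reducible : All (Reducible R ∘ lvar) α
    reducible = All.tabulate (guard-reducible I I' (proj₁ (proj₂ primed)) good)
    α≤W : length α ≤ W
    α≤W = ≤-trans (≤-trans (m≤m+n (length α) (length Y)) (m≤m+n _ 1)) d≤W
    Y≤W : length Y ≤ W
    Y≤W = ≤-trans (≤-trans (m≤n+m (length Y) (length α)) (m≤m+n _ 1)) d≤W
    Y'≤W : length Y' ≤ W
    Y'≤W = subst (_≤ W) (sym (length-mapLits (ren x b ps) Y)) Y≤W
    line≤U : size (⋀ α ⇒ R) ≤ U
    line≤U = begin
      suc (size (⋀ α) + 7) ≡⟨ +-suc (size (⋀ α)) 7 ⟨
      size (⋀ α) + 8       ≤⟨ +-mono-≤ (body≤M AND α α≤W) (*-monoʳ-≤ 8 1≤M) ⟩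
      9 * M                ≤⟨ *-monoˡ-≤ M (toWitness {a? = 9 ≤? maxWeight} _) ⟩
      maxWeight * M        ≡⟨ U-def ⟨
      U                    ∎
      where open ≤-Reasoning
    count≤ : (3 * length Y + 1) + (1 + (length α + ((length α + 1) + 1))) ≤ 4 * width d
    count≤ = ≤-trans (m≤m+n _ (2 * length α + length Y)) (≤-reflexive (count (length α) (length Y)))
      where
      count : ∀ a y → (3 * y + 1) + (1 + (a + ((a + 1) + 1))) + (2 * a + y) ≡ 4 * (a + y + 1)
      count = solve-∀

  equiv-chain : ∀ ps ts ts' {a a' Γ} → Equated Γ ps → PrimedChain x b ps (ts ∷ʳ a) (ts' ∷ʳ a') →
                All (Introduced P Γ) (ts ∷ʳ a) → All (Introduced P Γ) (ts' ∷ʳ a') →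
                All (GoodGuard P x b) (ts ∷ʳ a) → All (λ d → width d ≤ W) (ts ∷ʳ a) →
                Ends Γ (H ⇒ (var (new a) ⇔ var (new a'))) (suc (length ts) * (4 * W))
  equiv-chain ps [] [] equated (primed , _) (I ∷ []) (I' ∷ []) (good ∷ []) (a≤W ∷ []) =
    relax (≤-reflexive (sym (+-identityʳ _))) (equiv-primed ps _ _ equated primed I I' good a≤W)
  equiv-chain ps []      (_ ∷ ts') equated (_ , chain) _ _ _ _ = ⊥-elim (PrimedChain-[]ˡ ts' chain)
  equiv-chain ps (_ ∷ ts) []       equated (_ , chain) _ _ _ _ = ⊥-elim (PrimedChain-[]ʳ ts chain)
  equiv-chain ps (t ∷ ts) (t' ∷ ts') equated (primed , chain) (I ∷ Is) (I' ∷ Is') (good ∷ goods) (t≤W ∷ ts≤W)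
    = do (Γ⊆Δ , t⇔t') ← ends⇒proves (equiv-primed ps t t' equated primed I I' good t≤W)
         equiv-chain ((new t , new t') ∷ ps) ts ts' (t⇔t' ∷ All.map Γ⊆Δ equated) chain
           (All.map (Introduced-mono (λ e → e) Γ⊆Δ) Is) (All.map (Introduced-mono (λ e → e) Γ⊆Δ) Is')
           goods ts≤W

  chain-cost : ∀ k → 1 ≤ W → suc k * (4 * W) * U ≤ 24 * maxWeight * (W * W) * suc k
  chain-cost k 1≤W = begin
    suc k * (4 * W) * U                     ≡⟨ cong (suc k * (4 * W) *_) U-def ⟩
    suc k * (4 * W) * (maxWeight * M)       ≤⟨ *-monoʳ-≤ (suc k * (4 * W)) (*-monoʳ-≤ maxWeight M≤6W) ⟩
    suc k * (4 * W) * (maxWeight * (6 * W)) ≡⟨ reorder maxWeight k W ⟩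
    24 * maxWeight * (W * W) * suc k        ∎
    where
    open ≤-Reasoning
    M≤6W : M ≤ 6 * W
    M≤6W = ≤-trans (≤-reflexive (*-suc 3 W)) (≤-trans (+-monoˡ-≤ (3 * W) (*-monoʳ-≤ 3 1≤W))
                                                     (≤-reflexive (sym (*-distribʳ-+ W 3 3))))
    reorder : ∀ N k W → suc k * (4 * W) * (N * (6 * W)) ≡ 24 * N * (W * W) * suc k
    reorder = solve-∀

widths≤maxWidth : ∀ ds → All (λ d → width d ≤ maxWidth ds) ds
widths≤maxWidth []       = []
widths≤maxWidth (d ∷ ds) =
  m≤m⊔n _ _ ∷ All.map (λ w≤ → ≤-trans w≤ (m≤n⊔m (width d) _)) (widths≤maxWidth ds)

lemma10 : Σ ℕ λ c →
    (Φ : DQBF) → WellFormed Φ →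
    (P : Prefix) (Γ : List Fm) (π : Deriv (matrix Φ) (prefix Φ) [] P Γ) →
    (x b : ℕ) → P x ≡ just univ → Declared P b →
    (ts ts' : List Def) (a a' : Def) →
    InOrder π (ts ∷ʳ a) → InOrder π (ts' ∷ʳ a') →
    PrimedChain x b [] (ts ∷ʳ a) (ts' ∷ʳ a') →
    All (GoodGuard P x b) (ts ∷ʳ a) →
    Σ Prefix λ Q → Σ (List Fm) λ Δ → Σ (Deriv (matrix Φ) P Γ Q Δ) λ π' →
      Σ (List Fm) (λ Δ' → Δ ≡ ((var x ⇔ var b) ⇒ (var (new a) ⇔ var (new a'))) ∷ Δ')
      × dsize π' ≤ c * (maxWidth (a ∷ ts) * maxWidth (a ∷ ts)) * suc (length ts)
lemma10 = 24 * maxWeight , λ Φ _ P Γ π x b x-univ _ ts ts' a a' io io' chain goods →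
  let W = maxWidth (a ∷ ts)
      open Primed (matrix Φ) P x b W x-univ
      a≤W = All.head (widths≤maxWidth (a ∷ ts))
      widths≤W = ∷ʳ⁺ (All.tail (widths≤maxWidth (a ∷ ts))) a≤W
      F = equiv-chain [] ts ts' [] chain (inOrder⇒introduced io) (inOrder⇒introduced io') goods widths≤W
  in P , _ , Fragments.Frag.deriv F , Fragments.Frag.goal F ,
     ≤-trans (Fragments.Frag.cost F) (chain-cost (length ts) (≤-trans (m≤n+m 1 _) a≤W))
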